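{- There exists an absolute constant $C>0$ such that for every prime power $q$ and every $E\subset\mathbb{F}_q^2$, \[\left| L^2(D_E)-\frac{|E|^4}{q}\right|\le C\, q^2|E|^2,\] where $L^2(D_E)$ is the number of quadruples $(u,v,x,y)\in E^4$ such that $x\neq y$, $u\neq v$, and $u-v=\lambda(x-y)$ for some $\lambda\in\mathbb{F}_q\setminus\{0\}$.
   Context: $\mathbb{F}_q$ is the finite field with $q$ elements; $\mathbb{F}_q^2$ is the two-dimensional vector space over it. The paper writes $X\ll Y$ for $X\le CY$ with an absolute constant $C$. -}

module Defs where

open import Level using (0ℓ)
open import Data.Nat using (ℕ; suc)
open import Data.Bool using (Bool; true; false; T)
open import Data.Fin using (Fin)
open import Data.Fin.Properties using (_≟_; any?)
open import Data.Product using (_×_; _,_; ∃; ∃-syntax)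
open import Data.Product.Properties using (≡-dec)
open import Data.List using (List; length; filter; cartesianProduct; allFin)
open import Relation.Nullary using (¬_; Dec; yes; no)
open import Relation.Nullary.Decidable using (_×-dec_; ¬?)
open import Relation.Binary.PropositionalEquality using (_≡_)
open import Algebra.Structures using (IsCommutativeRing)
open import Data.Bool.Properties using (T?)

record FiniteField (q : ℕ) : Set where
  field
    _+_ _*_ : Fin q → Fin q → Fin q
    -_      : Fin q → Fin q
    0# 1#   : Fin q
    isCommutativeRing : IsCommutativeRing _≡_ _+_ _*_ -_ 0# 1#
    0≢1     : ¬ (0# ≡ 1#)
    inverse : ∀ x → ¬ (x ≡ 0#) → ∃[ y ] (x * y ≡ 1#)

module _ {q : ℕ} (F : FiniteField q) where
  open FiniteField F

  Point : Set
  Point = Fin q × Fin q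

  _≟P_ : (u v : Point) → Dec (u ≡ v)
  _≟P_ = ≡-dec _≟_ _≟_

  _-P_ : Point → Point → Point
  (a , b) -P (c , d) = (a + (- c)) , (b + (- d))

  _·P_ : Fin q → Point → Point
  l ·P (a , b) = (l * a) , (l * b)

  allPoints : List Point
  allPoints = cartesianProduct (allFin q) (allFin q)

  card : (Point → Bool) → ℕ
  card E = length (filter (λ u → T? (E u)) allPoints)

  Quad : (Point → Bool) → Point × Point × Point × Point → Set
  Quad E (u , v , x , y) =
    T (E u) × T (E v) × T (E x) × T (E y) ×
    ¬ (x ≡ y) × ¬ (u ≡ v) ×
    ∃[ l ] (¬ (l ≡ 0#) × ((u -P v) ≡ (l ·P (x -P y))))

  Quad? : (E : Point → Bool) → ∀ w → Dec (Quad E w)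
  Quad? E (u , v , x , y) =
    T? (E u) ×-dec T? (E v) ×-dec T? (E x) ×-dec T? (E y) ×-dec
    ¬? (x ≟P y) ×-dec ¬? (u ≟P v) ×-dec
    any? (λ l → ¬? (l ≟ 0#) ×-dec ((u -P v) ≟P (l ·P (x -P y))))

  allQuads : List (Point × Point × Point × Point)
  allQuads = cartesianProduct allPoints
               (cartesianProduct allPoints (cartesianProduct allPoints allPoints))

  L2 : (Point → Bool) → ℕ
  L2 E = length (filter (Quad? E) allQuads)

{-# OPTIONS --safe #-}

-- Index the q + 1 directions of 𝔽_q² by Maybe 𝔽_q and let N_d be the number of ordered pairs
-- of distinct points of E whose difference has direction d. A quadruple counted by L²(D_E) is
-- exactly a choice of two such pairs for the same direction, so L²(D_E) = Σ_d N_d². Each pair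
-- of distinct points has exactly one direction, so Σ_d N_d = |E|² − |E|; and N_d + |E| is the
-- sum of the squares of the sizes of E on the q lines of direction d, so by Cauchy–Schwarz
-- q (N_d + |E|) ≥ |E|². The excesses q (N_d + |E|) − |E|² are therefore non-negative with sum
-- (q² − |E|) |E|, and expanding Σ_d (q N_d)² around |E|² gives q L²(D_E) ≤ |E|⁴ + 4 q³ |E|²;
-- Cauchy–Schwarz applied to Σ_d N_d gives the matching lower bound.

module Submission where

open import Defs
open import Data.Nat using (ℕ)
open import Level using (Level)
open import Data.Bool using (Bool; T)
open import Data.Product using (_×_; _,_; proj₁; proj₂; ∃; ∃-syntax)
open import Data.List using (List; []; _∷_; _++_; map; length; filter; cartesianProduct)
open import Data.List.Membership.Propositional using (_∈_)
open import Data.List.Relation.Unary.Unique.Propositional using (Unique)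
open import Relation.Nullary using (¬_; Dec; yes; no)
open import Relation.Nullary.Decidable using (_×-dec_; ¬?)
open import Relation.Unary using (Pred; Decidable)
open import Relation.Binary using (DecidableEquality)
open import Relation.Binary.PropositionalEquality
open import Function.Bundles using (_⇔_; mk⇔; Equivalence)
open import Function.Base using (_∘_; id)

module FiniteSums where

  open import Data.Nat using (suc; _+_; _*_; _≤_; z≤n)
  open import Data.Nat.Properties
  open import Data.Nat.Tactic.RingSolver using (solve-∀)
  open import Data.Empty using (⊥-elim)
  open import Data.Sum using ([_,_]′)
  open import Data.List.Properties using (length-map; length-++)
  open import Data.List.Relation.Unary.All as All using (All; []; _∷_)
  open import Data.List.Relation.Unary.Any using (here; there)
  open import Data.List.Relation.Unary.AllPairs using (_∷_)

  private variable
    a b p : Level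
    A : Set a
    B : Set b
    P Q : Set p

  ⟦_⟧ : Dec P → ℕ
  ⟦ yes _ ⟧ = 1
  ⟦ no _ ⟧ = 0

  ⟦⟧-yes : (P? : Dec P) → P → ⟦ P? ⟧ ≡ 1
  ⟦⟧-yes (yes _) _ = refl
  ⟦⟧-yes (no ¬p) p = ⊥-elim (¬p p)

  ⟦⟧-no : (P? : Dec P) → ¬ P → ⟦ P? ⟧ ≡ 0
  ⟦⟧-no (yes p) ¬p = ⊥-elim (¬p p)
  ⟦⟧-no (no _) _ = refl

  ⟦⟧-cong : P ⇔ Q → (P? : Dec P) (Q? : Dec Q) → ⟦ P? ⟧ ≡ ⟦ Q? ⟧
  ⟦⟧-cong P⇔Q (yes p) Q? = sym (⟦⟧-yes Q? (Equivalence.to P⇔Q p))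
  ⟦⟧-cong P⇔Q (no ¬p) Q? = sym (⟦⟧-no Q? (λ q → ¬p (Equivalence.from P⇔Q q)))

  ⟦⟧-× : (P? : Dec P) (Q? : Dec Q) → ⟦ P? ×-dec Q? ⟧ ≡ ⟦ P? ⟧ * ⟦ Q? ⟧
  ⟦⟧-× (yes _) (yes _) = refl
  ⟦⟧-× (yes _) (no _) = refl
  ⟦⟧-× (no _) _ = refl

  ⟦¬⟧+⟦⟧≡1 : (P? : Dec P) → ⟦ ¬? P? ⟧ + ⟦ P? ⟧ ≡ 1
  ⟦¬⟧+⟦⟧≡1 (yes _) = refl
  ⟦¬⟧+⟦⟧≡1 (no _) = refl

  ⟦⟧-idem : (P? : Dec P) → ⟦ P? ⟧ * ⟦ P? ⟧ ≡ ⟦ P? ⟧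
  ⟦⟧-idem (yes _) = refl
  ⟦⟧-idem (no _) = refl

  ∑ : List A → (A → ℕ) → ℕ
  ∑ [] f = 0
  ∑ (x ∷ xs) f = f x + ∑ xs f

  ∑-syntax : List A → (A → ℕ) → ℕ
  ∑-syntax = ∑

  infix 5 ∑-syntax
  syntax ∑-syntax xs (λ x → e) = ∑[ x ∈ xs ] e

  ∑-cong : ∀ xs {f g : A → ℕ} → (∀ x → f x ≡ g x) → ∑ xs f ≡ ∑ xs g
  ∑-cong [] f≗g = refl
  ∑-cong (x ∷ xs) f≗g = cong₂ _+_ (f≗g x) (∑-cong xs f≗g)

  ∑-zero : ∀ {xs} {f : A → ℕ} → All (λ x → f x ≡ 0) xs → ∑ xs f ≡ 0
  ∑-zero [] = refl
  ∑-zero (fx≡0 ∷ rest) = cong₂ _+_ fx≡0 (∑-zero rest)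

  ∑-distrib-+ : ∀ xs (f g : A → ℕ) → ∑[ x ∈ xs ] (f x + g x) ≡ ∑ xs f + ∑ xs g
  ∑-distrib-+ [] f g = refl
  ∑-distrib-+ (x ∷ xs) f g = begin
    f x + g x + (∑[ y ∈ xs ] (f y + g y)) ≡⟨ cong (f x + g x +_) (∑-distrib-+ xs f g) ⟩
    f x + g x + (∑ xs f + ∑ xs g)         ≡⟨ +-+-interchange (f x) (g x) (∑ xs f) (∑ xs g) ⟩
    f x + ∑ xs f + (g x + ∑ xs g)         ∎
    where
    open ≡-Reasoning
    +-+-interchange : ∀ a b c d → a + b + (c + d) ≡ a + c + (b + d)
    +-+-interchange = solve-∀

  *-distribˡ-∑ : ∀ c xs (f : A → ℕ) → c * ∑ xs f ≡ ∑[ x ∈ xs ] c * f x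
  *-distribˡ-∑ c [] f = *-zeroʳ c
  *-distribˡ-∑ c (x ∷ xs) f =
    trans (*-distribˡ-+ c (f x) (∑ xs f)) (cong (c * f x +_) (*-distribˡ-∑ c xs f))

  *-distribʳ-∑ : ∀ c xs (f : A → ℕ) → ∑ xs f * c ≡ ∑[ x ∈ xs ] f x * c
  *-distribʳ-∑ c [] f = refl
  *-distribʳ-∑ c (x ∷ xs) f =
    trans (*-distribʳ-+ c (f x) (∑ xs f)) (cong (f x * c +_) (*-distribʳ-∑ c xs f))

  ∑-mono-≤ : ∀ xs {f g : A → ℕ} → (∀ x → f x ≤ g x) → ∑ xs f ≤ ∑ xs g
  ∑-mono-≤ [] f≤g = z≤n
  ∑-mono-≤ (x ∷ xs) f≤g = +-mono-≤ (f≤g x) (∑-mono-≤ xs f≤g)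

  ∑-const : ∀ (xs : List A) c → ∑[ x ∈ xs ] c ≡ length xs * c
  ∑-const [] c = refl
  ∑-const (x ∷ xs) c = cong (c +_) (∑-const xs c)

  ∑-++ : ∀ xs ys (f : A → ℕ) → ∑ (xs ++ ys) f ≡ ∑ xs f + ∑ ys f
  ∑-++ [] ys f = refl
  ∑-++ (x ∷ xs) ys f = trans (cong (f x +_) (∑-++ xs ys f)) (sym (+-assoc (f x) (∑ xs f) (∑ ys f)))

  ∑-map : ∀ (g : A → B) xs (f : B → ℕ) → ∑ (map g xs) f ≡ ∑[ x ∈ xs ] f (g x)
  ∑-map g [] f = refl
  ∑-map g (x ∷ xs) f = cong (f (g x) +_) (∑-map g xs f)

  ∑-comm : ∀ xs ys (f : A → B → ℕ) → ∑[ x ∈ xs ] ∑[ y ∈ ys ] f x y ≡ ∑[ y ∈ ys ] ∑[ x ∈ xs ] f x y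
  ∑-comm [] ys f = sym (∑-zero (All.universal (λ _ → refl) ys))
  ∑-comm (x ∷ xs) ys f = trans (cong (∑ ys (f x) +_) (∑-comm xs ys f))
                               (sym (∑-distrib-+ ys (f x) (λ y → ∑[ x ∈ xs ] f x y)))

  ∑*∑ : ∀ xs ys (f : A → ℕ) (g : B → ℕ) → ∑ xs f * ∑ ys g ≡ ∑[ x ∈ xs ] ∑[ y ∈ ys ] f x * g y
  ∑*∑ xs ys f g = trans (*-distribʳ-∑ (∑ ys g) xs f) (∑-cong xs (λ x → *-distribˡ-∑ (f x) ys g))

  ∑-cartesianProduct : ∀ xs ys (f : A × B → ℕ) →
                       ∑ (cartesianProduct xs ys) f ≡ ∑[ x ∈ xs ] ∑[ y ∈ ys ] f (x , y)
  ∑-cartesianProduct [] ys f = refl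
  ∑-cartesianProduct (x ∷ xs) ys f = begin
    ∑ (map (x ,_) ys ++ cartesianProduct xs ys) f        ≡⟨ ∑-++ (map (x ,_) ys) _ f ⟩
    ∑ (map (x ,_) ys) f + ∑ (cartesianProduct xs ys) f  ≡⟨ cong₂ _+_ (∑-map (x ,_) ys f) (∑-cartesianProduct xs ys f) ⟩
    (∑[ y ∈ ys ] f (x , y)) + (∑[ x ∈ xs ] ∑[ y ∈ ys ] f (x , y)) ∎
    where open ≡-Reasoning

  length-cartesianProduct : ∀ (xs : List A) (ys : List B) →
                            length (cartesianProduct xs ys) ≡ length xs * length ys
  length-cartesianProduct [] ys = refl
  length-cartesianProduct (x ∷ xs) ys = begin
    length (map (x ,_) ys ++ cartesianProduct xs ys)         ≡⟨ length-++ (map (x ,_) ys) ⟩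
    length (map (x ,_) ys) + length (cartesianProduct xs ys) ≡⟨ cong₂ _+_ (length-map (x ,_) ys)
                                                                          (length-cartesianProduct xs ys) ⟩
    length ys + length xs * length ys                        ∎
    where open ≡-Reasoning

  length-filter≡∑⟦⟧ : {P : Pred A p} (P? : Decidable P) (xs : List A) →
                      length (filter P? xs) ≡ ∑[ x ∈ xs ] ⟦ P? x ⟧
  length-filter≡∑⟦⟧ P? [] = refl
  length-filter≡∑⟦⟧ P? (x ∷ xs) with P? x
  ... | yes _ = cong suc (length-filter≡∑⟦⟧ P? xs)
  ... | no _ = length-filter≡∑⟦⟧ P? xs

  2xy≤x²+y² : ∀ x y → 2 * (x * y) ≤ x * x + y * y
  2xy≤x²+y² x y =
    [ ordered , (λ y≤x → subst₂ _≤_ (cong (2 *_) (*-comm y x)) (+-comm (y * y) (x * x)) (ordered y≤x)) ]′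
      (≤-total x y)
    where
    ordered : ∀ {x y} → x ≤ y → 2 * (x * y) ≤ x * x + y * y
    ordered {x} x≤y with d , refl ← m≤n⇒∃[o]m+o≡n x≤y =
      subst₂ _≤_ (lhs x d) (rhs x d) (m≤m+n (2 * (x * x) + 2 * (x * d)) (d * d))
      where
      lhs : ∀ x d → 2 * (x * x) + 2 * (x * d) ≡ 2 * (x * (x + d))
      lhs = solve-∀
      rhs : ∀ x d → 2 * (x * x) + 2 * (x * d) + d * d ≡ x * x + (x + d) * (x + d)
      rhs = solve-∀

  cauchySchwarz : ∀ (xs : List A) (f : A → ℕ) → ∑ xs f * ∑ xs f ≤ length xs * (∑[ x ∈ xs ] f x * f x)
  cauchySchwarz xs f = *-cancelˡ-≤ 2 (begin
    2 * (∑ xs f * ∑ xs f)                            ≡⟨ cong (2 *_) (∑*∑ xs xs f f) ⟩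
    2 * (∑[ x ∈ xs ] ∑[ y ∈ xs ] f x * f y)          ≡⟨ *-distribˡ-∑ 2 xs _ ⟩
    ∑[ x ∈ xs ] 2 * (∑[ y ∈ xs ] f x * f y)          ≡⟨ ∑-cong xs (λ x → *-distribˡ-∑ 2 xs _) ⟩
    ∑[ x ∈ xs ] ∑[ y ∈ xs ] 2 * (f x * f y)
      ≤⟨ ∑-mono-≤ xs (λ x → ∑-mono-≤ xs (λ y → 2xy≤x²+y² (f x) (f y))) ⟩
    ∑[ x ∈ xs ] ∑[ y ∈ xs ] (f x * f x + f y * f y)  ≡⟨ ∑-cong xs (λ x → ∑-distrib-+ xs _ _) ⟩
    ∑[ x ∈ xs ] ((∑[ y ∈ xs ] f x * f x) + ∑f²)      ≡⟨ ∑-distrib-+ xs _ _ ⟩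
    (∑[ x ∈ xs ] ∑[ y ∈ xs ] f x * f x) + (∑[ x ∈ xs ] ∑f²)
      ≡⟨ cong₂ _+_ (∑-cong xs (λ x → ∑-const xs (f x * f x))) (∑-const xs ∑f²) ⟩
    (∑[ x ∈ xs ] n * (f x * f x)) + n * ∑f²          ≡⟨ cong (_+ n * ∑f²) (sym (*-distribˡ-∑ n xs _)) ⟩
    n * ∑f² + n * ∑f²                                ≡⟨ double (n * ∑f²) ⟩
    2 * (n * ∑f²)                                    ∎)
    where
    open ≤-Reasoning
    n ∑f² : ℕ
    n = length xs
    ∑f² = ∑[ x ∈ xs ] f x * f x
    double : ∀ m → m + m ≡ 2 * m
    double = solve-∀

  ∑-squares≤square : ∀ (xs : List A) (f : A → ℕ) → ∑[ x ∈ xs ] f x * f x ≤ ∑ xs f * ∑ xs f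
  ∑-squares≤square [] f = z≤n
  ∑-squares≤square (x ∷ xs) f = begin
    f x * f x + (∑[ y ∈ xs ] f y * f y)                ≤⟨ +-monoʳ-≤ (f x * f x) (∑-squares≤square xs f) ⟩
    f x * f x + ∑ xs f * ∑ xs f                        ≤⟨ m≤n+m _ (2 * (f x * ∑ xs f)) ⟩
    2 * (f x * ∑ xs f) + (f x * f x + ∑ xs f * ∑ xs f) ≡⟨ square-+ (f x) (∑ xs f) ⟩
    (f x + ∑ xs f) * (f x + ∑ xs f)                    ∎
    where
    open ≤-Reasoning
    square-+ : ∀ m n → 2 * (m * n) + (m * m + n * n) ≡ (m + n) * (m + n)
    square-+ = solve-∀

  ∑-square-expand : ∀ (xs : List A) c (f : A → ℕ) →
                    ∑[ x ∈ xs ] (c + f x) * (c + f x)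
                    ≡ length xs * (c * c) + 2 * (c * ∑ xs f) + (∑[ x ∈ xs ] f x * f x)
  ∑-square-expand xs c f = begin
    ∑[ x ∈ xs ] (c + f x) * (c + f x)
      ≡⟨ ∑-cong xs (λ x → expand c (f x)) ⟩
    ∑[ x ∈ xs ] (c * c + 2 * c * f x + f x * f x)
      ≡⟨ ∑-distrib-+ xs _ _ ⟩
    (∑[ x ∈ xs ] (c * c + 2 * c * f x)) + ∑f²
      ≡⟨ cong (_+ ∑f²) (∑-distrib-+ xs _ _) ⟩
    (∑[ x ∈ xs ] c * c) + (∑[ x ∈ xs ] 2 * c * f x) + ∑f²
      ≡⟨ cong₂ (λ s t → s + t + ∑f²) (∑-const xs (c * c)) (sym (*-distribˡ-∑ (2 * c) xs f)) ⟩
    length xs * (c * c) + 2 * c * ∑ xs f + ∑f²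
      ≡⟨ cong (λ s → length xs * (c * c) + s + ∑f²) (*-assoc 2 c (∑ xs f)) ⟩
    length xs * (c * c) + 2 * (c * ∑ xs f) + ∑f² ∎
    where
    open ≡-Reasoning
    ∑f² : ℕ
    ∑f² = ∑[ x ∈ xs ] f x * f x
    expand : ∀ c m → (c + m) * (c + m) ≡ c * c + 2 * c * m + m * m
    expand = solve-∀

  ∑-single : ∀ {xs : List A} → Unique xs → {Q : Pred A p} (Q? : Decidable Q) {x₀ : A} → x₀ ∈ xs → Q x₀ →
             (∀ {x} → Q x → x ≡ x₀) → (f : A → ℕ) → ∑[ x ∈ xs ] ⟦ Q? x ⟧ * f x ≡ f x₀
  ∑-single (x∉xs ∷ _) Q? (here refl) Qx₀ only f =
    trans (cong₂ _+_ (trans (cong (_* f _) (⟦⟧-yes (Q? _) Qx₀)) (*-identityˡ (f _)))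
                     (∑-zero (All.map (λ x≢y → cong (_* f _) (⟦⟧-no (Q? _) (λ Qy → x≢y (sym (only Qy)))))
                                      x∉xs)))
          (+-identityʳ (f _))
  ∑-single (y∉xs ∷ unique) Q? (there x₀∈xs) Qx₀ only f =
    cong₂ _+_ (cong (_* f _) (⟦⟧-no (Q? _) (λ Qy → All.lookup y∉xs x₀∈xs (only Qy))))
              (∑-single unique Q? x₀∈xs Qx₀ only f)

  record IsEnumeration {A : Set a} (xs : List A) : Set a where
    field
      unique   : Unique xs
      complete : ∀ x → x ∈ xs

  module _ {xs : List A} (xs-enum : IsEnumeration xs) where

    open IsEnumeration xs-enum

    ∑-δ : (_≟_ : DecidableEquality A) (x₀ : A) (f : A → ℕ) → ∑[ x ∈ xs ] ⟦ x₀ ≟ x ⟧ * f x ≡ f x₀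
    ∑-δ _≟_ x₀ = ∑-single unique (x₀ ≟_) (complete x₀) refl sym

    ∑⟦⟧-atMostOne : {Q : Pred A p} (Q? : Decidable Q) → (∀ {x y} → Q x → Q y → x ≡ y) →
                    (P? : Dec P) → P ⇔ ∃ Q → ∑[ x ∈ xs ] ⟦ Q? x ⟧ ≡ ⟦ P? ⟧
    ∑⟦⟧-atMostOne Q? atMostOne (yes p) P⇔∃Q with x₀ , Qx₀ ← Equivalence.to P⇔∃Q p =
      trans (∑-cong xs (λ x → sym (*-identityʳ ⟦ Q? x ⟧)))
            (∑-single unique Q? (complete x₀) Qx₀ (λ Qx → atMostOne Qx Qx₀) (λ _ → 1))
    ∑⟦⟧-atMostOne Q? _ (no ¬p) P⇔∃Q =
      ∑-zero (All.universal (λ x → ⟦⟧-no (Q? x) (λ Qx → ¬p (Equivalence.from P⇔∃Q (x , Qx)))) xs)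

    ∑-offDiagonal : (_≟_ : DecidableEquality A) (f : A → A → ℕ) →
                    (∑[ x ∈ xs ] ∑[ y ∈ xs ] ⟦ ¬? (x ≟ y) ⟧ * f x y) + (∑[ x ∈ xs ] f x x)
                    ≡ ∑[ x ∈ xs ] ∑[ y ∈ xs ] f x y
    ∑-offDiagonal _≟_ f = begin
      (∑[ x ∈ xs ] ∑[ y ∈ xs ] ⟦ ¬? (x ≟ y) ⟧ * f x y) + (∑[ x ∈ xs ] f x x)
        ≡⟨ cong ((∑[ x ∈ xs ] ∑[ y ∈ xs ] ⟦ ¬? (x ≟ y) ⟧ * f x y) +_)
                (∑-cong xs (λ x → sym (∑-δ _≟_ x (f x)))) ⟩
      (∑[ x ∈ xs ] ∑[ y ∈ xs ] ⟦ ¬? (x ≟ y) ⟧ * f x y) + (∑[ x ∈ xs ] ∑[ y ∈ xs ] ⟦ x ≟ y ⟧ * f x y)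
        ≡⟨ sym (∑-distrib-+ xs _ _) ⟩
      ∑[ x ∈ xs ] ((∑[ y ∈ xs ] ⟦ ¬? (x ≟ y) ⟧ * f x y) + (∑[ y ∈ xs ] ⟦ x ≟ y ⟧ * f x y))
        ≡⟨ ∑-cong xs (λ x → sym (∑-distrib-+ xs _ _)) ⟩
      ∑[ x ∈ xs ] ∑[ y ∈ xs ] (⟦ ¬? (x ≟ y) ⟧ * f x y + ⟦ x ≟ y ⟧ * f x y)
        ≡⟨ ∑-cong xs (λ x → ∑-cong xs (λ y → split x y)) ⟩
      ∑[ x ∈ xs ] ∑[ y ∈ xs ] f x y ∎
      where
      open ≡-Reasoning
      split : ∀ x y → ⟦ ¬? (x ≟ y) ⟧ * f x y + ⟦ x ≟ y ⟧ * f x y ≡ f x y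
      split x y = begin
        ⟦ ¬? (x ≟ y) ⟧ * f x y + ⟦ x ≟ y ⟧ * f x y ≡⟨ sym (*-distribʳ-+ (f x y) ⟦ ¬? (x ≟ y) ⟧ _) ⟩
        (⟦ ¬? (x ≟ y) ⟧ + ⟦ x ≟ y ⟧) * f x y       ≡⟨ cong (_* f x y) (⟦¬⟧+⟦⟧≡1 (x ≟ y)) ⟩
        1 * f x y                                  ≡⟨ *-identityˡ (f x y) ⟩
        f x y                                      ∎

  module Fibres {ys : List B} (ys-enum : IsEnumeration ys) (_≟_ : DecidableEquality B)
                (xs : List A) (g : A → B) (w : A → ℕ) where

    fibre : B → ℕ
    fibre t = ∑[ u ∈ xs ] ⟦ g u ≟ t ⟧ * w u

    ∑-fibre : ∑ ys fibre ≡ ∑ xs w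
    ∑-fibre = begin
      ∑[ t ∈ ys ] ∑[ u ∈ xs ] ⟦ g u ≟ t ⟧ * w u ≡⟨ ∑-comm ys xs _ ⟩
      ∑[ u ∈ xs ] ∑[ t ∈ ys ] ⟦ g u ≟ t ⟧ * w u ≡⟨ ∑-cong xs (λ u → ∑-δ ys-enum _≟_ (g u) (λ _ → w u)) ⟩
      ∑ xs w                                     ∎
      where open ≡-Reasoning

    ∑-fibre² : ∑[ t ∈ ys ] fibre t * fibre t ≡ ∑[ u ∈ xs ] ∑[ v ∈ xs ] ⟦ g u ≟ g v ⟧ * (w u * w v)
    ∑-fibre² = begin
      ∑[ t ∈ ys ] fibre t * fibre t
        ≡⟨ ∑-cong ys (λ t → ∑*∑ xs xs _ _) ⟩
      ∑[ t ∈ ys ] ∑[ u ∈ xs ] ∑[ v ∈ xs ] (⟦ g u ≟ t ⟧ * w u) * (⟦ g v ≟ t ⟧ * w v)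
        ≡⟨ ∑-comm ys xs _ ⟩
      ∑[ u ∈ xs ] ∑[ t ∈ ys ] ∑[ v ∈ xs ] (⟦ g u ≟ t ⟧ * w u) * (⟦ g v ≟ t ⟧ * w v)
        ≡⟨ ∑-cong xs (λ u → ∑-comm ys xs _) ⟩
      ∑[ u ∈ xs ] ∑[ v ∈ xs ] ∑[ t ∈ ys ] (⟦ g u ≟ t ⟧ * w u) * (⟦ g v ≟ t ⟧ * w v)
        ≡⟨ ∑-cong xs (λ u → ∑-cong xs (λ v → pair u v)) ⟩
      ∑[ u ∈ xs ] ∑[ v ∈ xs ] ⟦ g u ≟ g v ⟧ * (w u * w v) ∎
      where
      open ≡-Reasoning
      regroup : ∀ a b c d → (a * b) * (c * d) ≡ a * (c * (b * d))
      regroup = solve-∀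
      pair : ∀ u v → ∑[ t ∈ ys ] (⟦ g u ≟ t ⟧ * w u) * (⟦ g v ≟ t ⟧ * w v) ≡ ⟦ g u ≟ g v ⟧ * (w u * w v)
      pair u v = begin
        ∑[ t ∈ ys ] (⟦ g u ≟ t ⟧ * w u) * (⟦ g v ≟ t ⟧ * w v)
          ≡⟨ ∑-cong ys (λ t → regroup ⟦ g u ≟ t ⟧ (w u) ⟦ g v ≟ t ⟧ (w v)) ⟩
        ∑[ t ∈ ys ] ⟦ g u ≟ t ⟧ * (⟦ g v ≟ t ⟧ * (w u * w v))
          ≡⟨ ∑-δ ys-enum _≟_ (g u) _ ⟩
        ⟦ g v ≟ g u ⟧ * (w u * w v)
          ≡⟨ cong (_* (w u * w v)) (⟦⟧-cong (mk⇔ sym sym) (g v ≟ g u) (g u ≟ g v)) ⟩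
        ⟦ g u ≟ g v ⟧ * (w u * w v) ∎

    fibre-cauchySchwarz : ∑ xs w * ∑ xs w ≤ length ys * (∑[ u ∈ xs ] ∑[ v ∈ xs ] ⟦ g u ≟ g v ⟧ * (w u * w v))
    fibre-cauchySchwarz = subst₂ (λ s s² → s * s ≤ length ys * s²) ∑-fibre ∑-fibre² (cauchySchwarz ys fibre)

module EnergyEstimate where

  open import Data.Nat using (ℕ; suc; _+_; _*_; _∸_; _≤_; NonZero)
  open import Data.Nat.Properties
  open import Data.Nat.Tactic.RingSolver using (solve-∀)
  open import Data.Sum using (inj₁; inj₂)
  open import Data.Integer using (+_; _-_; ∣_∣)
  import Data.Integer.Properties as ℤ
  open FiniteSums

  ∣+m-+n∣≤o : ∀ m n o → m ≤ n + o → n ≤ m + o → ∣ + m - + n ∣ ≤ o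
  ∣+m-+n∣≤o m n o m≤n+o n≤m+o rewrite ℤ.m-n≡m⊖n m n with ≤-total m n
  ... | inj₁ m≤n rewrite ℤ.∣⊖∣-≤ m≤n = m≤n+o⇒m∸n≤o n m n≤m+o
  ... | inj₂ n≤m rewrite ℤ.∣m⊖n∣≡∣n⊖m∣ m n | ℤ.∣⊖∣-≤ n≤m = m≤n+o⇒m∸n≤o m n m≤n+o

  module _ {A : Set} (ds : List A) (N : A → ℕ) (q e : ℕ) .{{_ : NonZero q}}
           (length-ds : length ds ≡ suc q) (∑N+e≡e² : ∑ ds N + e ≡ e * e) (e≤q² : e ≤ q * q) where

    L e⁴ X : ℕ
    L = ∑[ d ∈ ds ] N d * N d
    e⁴ = e * e * (e * e)
    X = q * q * q * (e * e)

    e²≤q⁴ : e * e ≤ q * q * (q * q)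
    e²≤q⁴ = *-mono-≤ e≤q² e≤q²

    module _ (e²≤q[N+e] : ∀ d → e * e ≤ q * (N d + e)) where

      excess : A → ℕ
      excess d = q * (N d + e) ∸ e * e

      e²+excess≡q[N+e] : ∀ d → e * e + excess d ≡ q * (N d + e)
      e²+excess≡q[N+e] d = m+[n∸m]≡n (e²≤q[N+e] d)

      e²+∑excess≡q²e : e * e + ∑ ds excess ≡ q * q * e
      e²+∑excess≡q²e = +-cancelˡ-≡ (q * (e * e)) _ _ (begin
        q * (e * e) + (e * e + ∑ ds excess)   ≡⟨ shift q (e * e) (∑ ds excess) ⟩
        suc q * (e * e) + ∑ ds excess         ≡⟨ cong (λ n → n * (e * e) + ∑ ds excess) (sym length-ds) ⟩
        length ds * (e * e) + ∑ ds excess     ≡⟨ cong (_+ ∑ ds excess) (sym (∑-const ds (e * e))) ⟩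
        (∑[ d ∈ ds ] e * e) + ∑ ds excess     ≡⟨ sym (∑-distrib-+ ds _ excess) ⟩
        ∑[ d ∈ ds ] (e * e + excess d)        ≡⟨ ∑-cong ds e²+excess≡q[N+e] ⟩
        ∑[ d ∈ ds ] q * (N d + e)             ≡⟨ sym (*-distribˡ-∑ q ds _) ⟩
        q * (∑[ d ∈ ds ] (N d + e))           ≡⟨ cong (q *_) (∑-distrib-+ ds N (λ _ → e)) ⟩
        q * (∑ ds N + (∑[ d ∈ ds ] e))        ≡⟨ cong (λ s → q * (∑ ds N + s))
                                                      (trans (∑-const ds e) (cong (_* e) length-ds)) ⟩
        q * (∑ ds N + suc q * e)              ≡⟨ unfold q (∑ ds N) e ⟩
        q * (∑ ds N + e) + q * q * e          ≡⟨ cong (λ s → q * s + q * q * e) ∑N+e≡e² ⟩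
        q * (e * e) + q * q * e               ∎)
        where
        open ≡-Reasoning
        shift : ∀ q m n → q * m + (m + n) ≡ suc q * m + n
        shift = solve-∀
        unfold : ∀ q s e → q * (s + suc q * e) ≡ q * (s + e) + q * q * e
        unfold = solve-∀

      ∑excess≤q²e : ∑ ds excess ≤ q * q * e
      ∑excess≤q²e = subst (∑ ds excess ≤_) e²+∑excess≡q²e (m≤n+m (∑ ds excess) (e * e))

      q²L≤ : q * q * L ≤ suc q * e⁴ + 2 * (e * e * (q * q * e)) + (q * q * e) * (q * q * e)
      q²L≤ = begin
        q * q * L
          ≡⟨ trans (*-distribˡ-∑ (q * q) ds _) (∑-cong ds (λ d → square-* q (N d))) ⟩
        ∑[ d ∈ ds ] (q * N d) * (q * N d)
          ≤⟨ ∑-mono-≤ ds (λ d → *-mono-≤ (qN≤e²+excess d) (qN≤e²+excess d)) ⟩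
        ∑[ d ∈ ds ] (e * e + excess d) * (e * e + excess d)
          ≡⟨ ∑-square-expand ds (e * e) excess ⟩
        length ds * e⁴ + 2 * (e * e * ∑ ds excess) + (∑[ d ∈ ds ] excess d * excess d)
          ≡⟨ cong (λ n → n * e⁴ + 2 * (e * e * ∑ ds excess) + (∑[ d ∈ ds ] excess d * excess d)) length-ds ⟩
        suc q * e⁴ + 2 * (e * e * ∑ ds excess) + (∑[ d ∈ ds ] excess d * excess d)
          ≤⟨ +-mono-≤ (+-monoʳ-≤ (suc q * e⁴) (*-monoʳ-≤ 2 (*-monoʳ-≤ (e * e) ∑excess≤q²e)))
                      (≤-trans (∑-squares≤square ds excess) (*-mono-≤ ∑excess≤q²e ∑excess≤q²e)) ⟩
        suc q * e⁴ + 2 * (e * e * (q * q * e)) + (q * q * e) * (q * q * e) ∎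
        where
        open ≤-Reasoning
        qN≤e²+excess : ∀ d → q * N d ≤ e * e + excess d
        qN≤e²+excess d = subst (q * N d ≤_) (sym (e²+excess≡q[N+e] d)) (*-monoʳ-≤ q (m≤m+n (N d) e))
        square-* : ∀ q n → q * q * (n * n) ≡ (q * n) * (q * n)
        square-* = solve-∀

      energy-upper : q * L ≤ e⁴ + 4 * X
      energy-upper = *-cancelˡ-≤ q (begin
        q * (q * L)                      ≡⟨ sym (*-assoc q q L) ⟩
        q * q * L                        ≤⟨ q²L≤ ⟩
        suc q * e⁴ + 2 * (e * e * (q * q * e)) + (q * q * e) * (q * q * e)
          ≡⟨ regroup q e ⟩
        q * e⁴ + (e⁴ + 2 * (q * q * e * (e * e))) + q * q * (q * q) * (e * e)
          ≤⟨ +-monoˡ-≤ (q * q * (q * q) * (e * e))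
               (+-monoʳ-≤ (q * e⁴)
                 (+-mono-≤ (*-monoˡ-≤ (e * e) e²≤q⁴) (*-monoʳ-≤ 2 (*-monoˡ-≤ (e * e) (*-monoʳ-≤ (q * q) e≤q²))))) ⟩
        q * e⁴ + (q * q * (q * q) * (e * e) + 2 * (q * q * (q * q) * (e * e))) + q * q * (q * q) * (e * e)
          ≡⟨ collect q e ⟩
        q * (e⁴ + 4 * X)                 ∎)
        where
        open ≤-Reasoning
        regroup : ∀ q e → suc q * (e * e * (e * e)) + 2 * (e * e * (q * q * e)) + (q * q * e) * (q * q * e)
                          ≡ q * (e * e * (e * e)) + (e * e * (e * e) + 2 * (q * q * e * (e * e)))
                            + q * q * (q * q) * (e * e)
        regroup = solve-∀
        collect : ∀ q e → q * (e * e * (e * e)) + (q * q * (q * q) * (e * e) + 2 * (q * q * (q * q) * (e * e)))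
                            + q * q * (q * q) * (e * e)
                          ≡ q * (e * e * (e * e) + 4 * (q * q * q * (e * e)))
        collect = solve-∀

    L≤5X : q * L ≤ e⁴ + 4 * X → L ≤ 5 * X
    L≤5X qL≤ = *-cancelˡ-≤ q (begin
      q * L                                   ≤⟨ qL≤ ⟩
      e⁴ + 4 * X                              ≤⟨ +-mono-≤ (*-monoˡ-≤ (e * e) e²≤q⁴) (m≤n*m (4 * X) q) ⟩
      q * q * (q * q) * (e * e) + q * (4 * X) ≡⟨ factor q (e * e) ⟩
      q * (5 * X)                             ∎)
      where
      open ≤-Reasoning
      factor : ∀ q m → q * q * (q * q) * m + q * (4 * (q * q * q * m)) ≡ q * (5 * (q * q * q * m))
      factor = solve-∀

    energy-lower : q * L ≤ e⁴ + 4 * X → e⁴ ≤ q * L + 8 * X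
    energy-lower qL≤ = begin
      e * e * (e * e)                    ≡⟨ cong (λ s → s * s) (sym ∑N+e≡e²) ⟩
      (S + e) * (S + e)                  ≡⟨ expand S e ⟩
      S * S + 2 * (e * S) + e * e
        ≤⟨ +-monoˡ-≤ (e * e) (+-mono-≤ (subst (λ n → S * S ≤ n * L) length-ds (cauchySchwarz ds N))
                                       (*-monoʳ-≤ 2 (*-monoʳ-≤ e S≤e²))) ⟩
      suc q * L + 2 * (e * (e * e)) + e * e
        ≤⟨ +-mono-≤ (+-monoʳ-≤ (suc q * L) (*-monoʳ-≤ 2 (*-monoˡ-≤ (e * e) e≤q³)))
                    (m≤n*m (e * e) (q * q * q) {{q³≢0}}) ⟩
      suc q * L + 2 * X + X              ≡⟨ regroup q L X ⟩
      q * L + L + 3 * X                  ≤⟨ +-monoˡ-≤ (3 * X) (+-monoʳ-≤ (q * L) (L≤5X qL≤)) ⟩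
      q * L + 5 * X + 3 * X              ≡⟨ collect (q * L) X ⟩
      q * L + 8 * X                      ∎
      where
      open ≤-Reasoning
      S : ℕ
      S = ∑ ds N
      S≤e² : S ≤ e * e
      S≤e² = subst (S ≤_) ∑N+e≡e² (m≤m+n S e)
      q³≢0 : NonZero (q * q * q)
      q³≢0 = m*n≢0 (q * q) q {{m*n≢0 q q}}
      e≤q³ : e ≤ q * q * q
      e≤q³ = ≤-trans e≤q² (m≤m*n (q * q) q)
      expand : ∀ s e → (s + e) * (s + e) ≡ s * s + 2 * (e * s) + e * e
      expand = solve-∀
      regroup : ∀ q l x → suc q * l + 2 * x + x ≡ q * l + l + 3 * x
      regroup = solve-∀
      collect : ∀ m x → m + 5 * x + 3 * x ≡ m + 8 * x
      collect = solve-∀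

    energy-estimate : (∀ d → e * e ≤ q * (N d + e)) → ∣ + (q * L) - + e⁴ ∣ ≤ 8 * X
    energy-estimate e²≤q[N+e] =
      ∣+m-+n∣≤o _ _ _ (≤-trans upper (+-monoʳ-≤ e⁴ (*-monoˡ-≤ X (m≤m+n 4 4)))) (energy-lower upper)
      where
      upper : q * L ≤ e⁴ + 4 * X
      upper = energy-upper e²≤q[N+e]

module PlaneGeometry {q : ℕ} (F : FiniteField q) where

  open import Level using (0ℓ)
  open import Data.Fin using (Fin)
  open import Data.Fin.Properties using (_≟_)
  open import Data.Maybe using (Maybe; just; nothing)
  open import Data.Empty using (⊥-elim)
  open import Algebra.Bundles using (CommutativeRing)
  import Algebra.Properties.CommutativeSemigroup as CommutativeSemigroupProperties

  commutativeRing : CommutativeRing 0ℓ 0ℓ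
  commutativeRing = record { isCommutativeRing = FiniteField.isCommutativeRing F }

  open CommutativeRing commutativeRing
    using (_+_; _*_; -_; _-_; 0#; 1#; ring; *-commutativeSemigroup; +-commutativeSemigroup;
           *-assoc; *-identityʳ; zeroˡ; zeroʳ)
  open import Algebra.Properties.Ring ring using (x[y-z]≈xy-xz; -‿+-comm; x∙y⁻¹≈ε⇒x≈y; x≈y⇒x∙y⁻¹≈ε)
  open CommutativeSemigroupProperties *-commutativeSemigroup using (x∙yz≈y∙xz; xy∙z≈xz∙y; xy∙z≈zy∙x)
  open CommutativeSemigroupProperties +-commutativeSemigroup using (interchange)

  K : Set
  K = Fin q

  inv : (a : K) → ¬ a ≡ 0# → K
  inv a a≢0 = proj₁ (FiniteField.inverse F a a≢0)

  x*a*a⁻¹≡x : ∀ x a (a≢0 : ¬ a ≡ 0#) → x * a * inv a a≢0 ≡ x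
  x*a*a⁻¹≡x x a a≢0 = begin
    x * a * inv a a≢0     ≡⟨ *-assoc x a _ ⟩
    x * (a * inv a a≢0)   ≡⟨ cong (x *_) (proj₂ (FiniteField.inverse F a a≢0)) ⟩
    x * 1#                ≡⟨ *-identityʳ x ⟩
    x                     ∎
    where open ≡-Reasoning

  x*a⁻¹*a≡x : ∀ x a (a≢0 : ¬ a ≡ 0#) → x * inv a a≢0 * a ≡ x
  x*a⁻¹*a≡x x a a≢0 = trans (xy∙z≈xz∙y x (inv a a≢0) a) (x*a*a⁻¹≡x x a a≢0)

  [a-b]-[c-d]≡[a-c]-[b-d] : ∀ a b c d → (a - b) - (c - d) ≡ (a - c) - (b - d)
  [a-b]-[c-d]≡[a-c]-[b-d] a b c d = begin
    (a - b) - (c - d)           ≡⟨ cong ((a - b) +_) (sym (-‿+-comm c (- d))) ⟩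
    (a - b) + (- c + - (- d))   ≡⟨ interchange a (- b) (- c) (- (- d)) ⟩
    (a - c) + (- b + - (- d))   ≡⟨ cong ((a - c) +_) (-‿+-comm b (- d)) ⟩
    (a - c) - (b - d)           ∎
    where open ≡-Reasoning

  Direction : Set
  Direction = Maybe K

  origin : Point F
  origin = 0# , 0#

  _-ᴾ_ : Point F → Point F → Point F
  _-ᴾ_ = _-P_ F

  _·ᴾ_ : K → Point F → Point F
  _·ᴾ_ = _·P_ F

  -- π d w ≡ 0# exactly when w lies on the line through the origin with direction d:
  -- the vertical line for nothing, the line of slope t for just t.
  π : Direction → Point F → K
  π nothing (a , b) = a
  π (just t) (a , b) = b - t * a

  direction : Point F → Direction
  direction (a , b) with a ≟ 0#
  ... | yes _ = nothing
  ... | no a≢0 = just (b * inv a a≢0)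

  π-sub : ∀ d x y → π d (x -ᴾ y) ≡ π d x - π d y
  π-sub nothing x y = refl
  π-sub (just t) (x₁ , x₂) (y₁ , y₂) = begin
    (x₂ - y₂) - t * (x₁ - y₁)          ≡⟨ cong (λ z → (x₂ - y₂) - z) (x[y-z]≈xy-xz t x₁ y₁) ⟩
    (x₂ - y₂) - (t * x₁ - t * y₁)      ≡⟨ [a-b]-[c-d]≡[a-c]-[b-d] x₂ y₂ (t * x₁) (t * y₁) ⟩
    (x₂ - t * x₁) - (y₂ - t * y₁)      ∎
    where open ≡-Reasoning

  π-scale : ∀ d l w → π d (l ·ᴾ w) ≡ l * π d w
  π-scale nothing l w = refl
  π-scale (just t) l (a , b) = begin
    l * b - t * (l * a)     ≡⟨ cong (λ z → l * b - z) (x∙yz≈y∙xz t l a) ⟩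
    l * b - l * (t * a)     ≡⟨ sym (x[y-z]≈xy-xz l b (t * a)) ⟩
    l * (b - t * a)         ∎
    where open ≡-Reasoning

  π≡⇔π-sub≡0 : ∀ d x y → π d x ≡ π d y ⇔ π d (x -ᴾ y) ≡ 0#
  π≡⇔π-sub≡0 d x y = mk⇔
    (λ πx≡πy → trans (π-sub d x y) (x≈y⇒x∙y⁻¹≈ε πx≡πy))
    (λ π[x-y]≡0 → x∙y⁻¹≈ε⇒x≈y (π d x) (π d y) (trans (sym (π-sub d x y)) π[x-y]≡0))

  -ᴾ≢origin : ∀ {x y} → ¬ x ≡ y → ¬ x -ᴾ y ≡ origin
  -ᴾ≢origin {x₁ , x₂} {y₁ , y₂} x≢y x-y≡0 =
    x≢y (cong₂ _,_ (x∙y⁻¹≈ε⇒x≈y x₁ y₁ (cong proj₁ x-y≡0)) (x∙y⁻¹≈ε⇒x≈y x₂ y₂ (cong proj₂ x-y≡0)))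

  π-direction : ∀ w → π (direction w) w ≡ 0#
  π-direction (a , b) with a ≟ 0#
  ... | yes a≡0 = a≡0
  ... | no a≢0 = x≈y⇒x∙y⁻¹≈ε (sym (x*a⁻¹*a≡x b a a≢0))

  π≡0⇒direction : ∀ d w → ¬ w ≡ origin → π d w ≡ 0# → d ≡ direction w
  π≡0⇒direction nothing (a , b) w≢0 a≡0 with a ≟ 0#
  ... | yes _ = refl
  ... | no a≢0 = ⊥-elim (a≢0 a≡0)
  π≡0⇒direction (just t) (a , b) w≢0 πw≡0 with a ≟ 0#
  ... | yes a≡0 = ⊥-elim (w≢0 (cong₂ _,_ a≡0 (trans b≡ta (trans (cong (t *_) a≡0) (zeroʳ t)))))
    where
    b≡ta : b ≡ t * a
    b≡ta = x∙y⁻¹≈ε⇒x≈y b (t * a) πw≡0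
  ... | no a≢0 = cong just (sym (trans (cong (_* inv a a≢0) (x∙y⁻¹≈ε⇒x≈y b (t * a) πw≡0))
                                       (x*a*a⁻¹≡x t a a≢0)))

  π-direction≡0⇒multiple : ∀ w w′ → ¬ w ≡ origin → π (direction w) w′ ≡ 0# → ∃[ l ] (w′ ≡ l ·ᴾ w)
  π-direction≡0⇒multiple (a , b) (c , d) w≢0 πw′≡0 with a ≟ 0#
  ... | yes a≡0 = d * inv b b≢0 , cong₂ _,_ c≡la (sym (x*a⁻¹*a≡x d b b≢0))
    where
    b≢0 : ¬ b ≡ 0#
    b≢0 b≡0 = w≢0 (cong₂ _,_ a≡0 b≡0)
    c≡la : c ≡ d * inv b b≢0 * a
    c≡la = trans πw′≡0 (trans (sym (zeroʳ _)) (cong (d * inv b b≢0 *_) (sym a≡0)))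
  ... | no a≢0 = c * inv a a≢0 , cong₂ _,_ (sym (x*a⁻¹*a≡x c a a≢0))
                                           (trans (x∙y⁻¹≈ε⇒x≈y d _ πw′≡0) (xy∙z≈zy∙x b (inv a a≢0) c))

  0·ᴾ≡origin : ∀ w → 0# ·ᴾ w ≡ origin
  0·ᴾ≡origin (a , b) = cong₂ _,_ (zeroˡ a) (zeroˡ b)

  π-direction≡0⇔parallel : ∀ w w′ → ¬ w ≡ origin → ¬ w′ ≡ origin →
                           π (direction w) w′ ≡ 0# ⇔ (∃[ l ] (¬ l ≡ 0# × w′ ≡ l ·ᴾ w))
  π-direction≡0⇔parallel w w′ w≢0 w′≢0 = mk⇔ to from
    where
    to : π (direction w) w′ ≡ 0# → ∃[ l ] (¬ l ≡ 0# × w′ ≡ l ·ᴾ w)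
    to πw′≡0 with l , w′≡lw ← π-direction≡0⇒multiple w w′ w≢0 πw′≡0 =
      l , (λ l≡0 → w′≢0 (trans w′≡lw (trans (cong (_·ᴾ w) l≡0) (0·ᴾ≡origin w)))) , w′≡lw
    from : ∃[ l ] (¬ l ≡ 0# × w′ ≡ l ·ᴾ w) → π (direction w) w′ ≡ 0#
    from (l , _ , w′≡lw) = begin
      π (direction w) w′          ≡⟨ cong (π (direction w)) w′≡lw ⟩
      π (direction w) (l ·ᴾ w)    ≡⟨ π-scale (direction w) l w ⟩
      l * π (direction w) w       ≡⟨ cong (l *_) (π-direction w) ⟩
      l * 0#                      ≡⟨ zeroʳ l ⟩
      0#                          ∎
      where open ≡-Reasoning

module Counting {q : ℕ} (F : FiniteField q) (E : Point F → Bool) where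

  open import Data.Nat using (suc; _+_; _*_; _≤_)
  open import Data.Nat.Properties using (≤-trans; ≤-reflexive; *-identityˡ)
  open import Data.Bool.Properties using (T?)
  open import Data.Fin.Properties using (_≟_)
  open import Data.Maybe using (just; nothing)
  open import Data.Maybe.Properties using (just-injective)
  open import Data.List using (allFin)
  open import Data.List.Properties using (length-filter; length-map; length-tabulate)
  open import Data.List.Relation.Unary.All using (universal)
  open import Data.List.Relation.Unary.All.Properties using () renaming (map⁺ to All-map⁺)
  open import Data.List.Relation.Unary.Any using (here; there)
  open import Data.List.Relation.Unary.AllPairs using (_∷_)
  open import Data.List.Relation.Unary.Unique.Propositional.Properties
    using (allFin⁺; cartesianProduct⁺) renaming (map⁺ to Unique-map⁺)
  open import Data.List.Membership.Propositional.Properties using (∈-map⁺; ∈-allFin; ∈-cartesianProduct⁺)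
  open FiniteSums
  open PlaneGeometry F
    using (Direction; π; direction; _-ᴾ_; π≡⇔π-sub≡0; -ᴾ≢origin; π-direction; π≡0⇒direction;
           π-direction≡0⇔parallel)

  length-allFin : length (allFin q) ≡ q
  length-allFin = length-tabulate id

  allFin-enum : IsEnumeration (allFin q)
  allFin-enum = record { unique = allFin⁺ q ; complete = ∈-allFin }

  points : List (Point F)
  points = allPoints F

  points-enum : IsEnumeration points
  points-enum = record
    { unique   = cartesianProduct⁺ (allFin⁺ q) (allFin⁺ q)
    ; complete = λ (a , b) → ∈-cartesianProduct⁺ (∈-allFin a) (∈-allFin b)
    }

  directions : List Direction
  directions = nothing ∷ map just (allFin q)

  directions-enum : IsEnumeration directions
  directions-enum = record
    { unique   = All-map⁺ (universal (λ _ ()) (allFin q)) ∷ Unique-map⁺ just-injective (allFin⁺ q)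
    ; complete = complete
    }
    where
    complete : ∀ d → d ∈ directions
    complete nothing = here refl
    complete (just t) = there (∈-map⁺ just (∈-allFin t))

  length-directions : length directions ≡ suc q
  length-directions = cong suc (trans (length-map just (allFin q)) length-allFin)

  χ : Point F → ℕ
  χ u = ⟦ T? (E u) ⟧

  card≡∑χ : card F E ≡ ∑ points χ
  card≡∑χ = length-filter≡∑⟦⟧ (λ u → T? (E u)) points

  card≤q² : card F E ≤ q * q
  card≤q² = ≤-trans (length-filter (λ u → T? (E u)) points)
                    (≤-reflexive (trans (length-cartesianProduct (allFin q) (allFin q))
                                        (cong₂ _*_ length-allFin length-allFin)))

  _≟ᴾ_ : DecidableEquality (Point F)
  _≟ᴾ_ = _≟P_ F

  Distinct : Point F × Point F → Set
  Distinct (u , v) = ¬ u ≡ v × T (E u) × T (E v)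

  Distinct? : Decidable Distinct
  Distinct? (u , v) = ¬? (u ≟ᴾ v) ×-dec (T? (E u) ×-dec T? (E v))

  Aligned : Direction → Point F × Point F → Set
  Aligned d (u , v) = ¬ u ≡ v × π d u ≡ π d v × T (E u) × T (E v)

  Aligned? : ∀ d → Decidable (Aligned d)
  Aligned? d (u , v) = ¬? (u ≟ᴾ v) ×-dec ((π d u ≟ π d v) ×-dec (T? (E u) ×-dec T? (E v)))

  pairs : List (Point F × Point F)
  pairs = cartesianProduct points points

  alignedPairs : Direction → ℕ
  alignedPairs d = ∑[ p ∈ pairs ] ⟦ Aligned? d p ⟧

  aligned⇒direction : ∀ d {u v} → Aligned d (u , v) → d ≡ direction (u -ᴾ v)
  aligned⇒direction d {u} {v} (u≢v , πu≡πv , _) =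
    π≡0⇒direction d (u -ᴾ v) (-ᴾ≢origin u≢v) (Equivalence.to (π≡⇔π-sub≡0 d u v) πu≡πv)

  distinct⇒aligned : ∀ {u v} → Distinct (u , v) → Aligned (direction (u -ᴾ v)) (u , v)
  distinct⇒aligned {u} {v} (u≢v , Eu , Ev) =
    u≢v , Equivalence.from (π≡⇔π-sub≡0 (direction (u -ᴾ v)) u v) (π-direction (u -ᴾ v)) , Eu , Ev

  ⟦aligned⟧ : ∀ d u v → ⟦ Aligned? d (u , v) ⟧ ≡ ⟦ ¬? (u ≟ᴾ v) ⟧ * (⟦ π d u ≟ π d v ⟧ * (χ u * χ v))
  ⟦aligned⟧ d u v =
    trans (⟦⟧-× (¬? (u ≟ᴾ v)) _) (cong (⟦ ¬? (u ≟ᴾ v) ⟧ *_)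
      (trans (⟦⟧-× (π d u ≟ π d v) _) (cong (⟦ π d u ≟ π d v ⟧ *_) (⟦⟧-× (T? (E u)) (T? (E v))))))

  ⟦distinct⟧ : ∀ u v → ⟦ Distinct? (u , v) ⟧ ≡ ⟦ ¬? (u ≟ᴾ v) ⟧ * (χ u * χ v)
  ⟦distinct⟧ u v = trans (⟦⟧-× (¬? (u ≟ᴾ v)) _) (cong (⟦ ¬? (u ≟ᴾ v) ⟧ *_) (⟦⟧-× (T? (E u)) (T? (E v))))

  alignedPairs+card≡∑∑⟦π≡π⟧ : ∀ d → alignedPairs d + card F E
                               ≡ ∑[ u ∈ points ] ∑[ v ∈ points ] ⟦ π d u ≟ π d v ⟧ * (χ u * χ v)
  alignedPairs+card≡∑∑⟦π≡π⟧ d = begin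
    alignedPairs d + card F E
      ≡⟨ cong₂ _+_ (trans (∑-cartesianProduct points points _)
                          (∑-cong points (λ u → ∑-cong points (λ v → ⟦aligned⟧ d u v))))
                   (trans card≡∑χ (∑-cong points diagonal)) ⟩
    (∑[ u ∈ points ] ∑[ v ∈ points ] ⟦ ¬? (u ≟ᴾ v) ⟧ * (⟦ π d u ≟ π d v ⟧ * (χ u * χ v)))
      + (∑[ u ∈ points ] ⟦ π d u ≟ π d u ⟧ * (χ u * χ u))
      ≡⟨ ∑-offDiagonal points-enum _≟ᴾ_ (λ u v → ⟦ π d u ≟ π d v ⟧ * (χ u * χ v)) ⟩
    ∑[ u ∈ points ] ∑[ v ∈ points ] ⟦ π d u ≟ π d v ⟧ * (χ u * χ v) ∎
    where
    open ≡-Reasoning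
    diagonal : ∀ u → χ u ≡ ⟦ π d u ≟ π d u ⟧ * (χ u * χ u)
    diagonal u = sym (trans (cong (_* (χ u * χ u)) (⟦⟧-yes (π d u ≟ π d u) refl))
                            (trans (*-identityˡ (χ u * χ u)) (⟦⟧-idem (T? (E u)))))

  card²≤q[alignedPairs+card] : ∀ d → card F E * card F E ≤ q * (alignedPairs d + card F E)
  card²≤q[alignedPairs+card] d =
    subst₂ (λ e n → e * e ≤ n * (alignedPairs d + card F E)) (sym card≡∑χ) length-allFin
      (subst (λ s → ∑ points χ * ∑ points χ ≤ length (allFin q) * s) (sym (alignedPairs+card≡∑∑⟦π≡π⟧ d))
        (Fibres.fibre-cauchySchwarz allFin-enum _≟_ points (π d) χ))

  ∑-directions-aligned : ∀ p → ∑[ d ∈ directions ] ⟦ Aligned? d p ⟧ ≡ ⟦ Distinct? p ⟧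
  ∑-directions-aligned (u , v) =
    ∑⟦⟧-atMostOne directions-enum (λ d → Aligned? d (u , v))
      (λ {d} {d′} Ad Ad′ → trans (aligned⇒direction d Ad) (sym (aligned⇒direction d′ Ad′)))
      (Distinct? (u , v))
      (mk⇔ (λ distinct → direction (u -ᴾ v) , distinct⇒aligned distinct)
           (λ (_ , u≢v , _ , Eu , Ev) → u≢v , Eu , Ev))

  ∑alignedPairs+card≡card² : ∑ directions alignedPairs + card F E ≡ card F E * card F E
  ∑alignedPairs+card≡card² = begin
    ∑ directions alignedPairs + card F E
      ≡⟨ cong₂ _+_ ∑alignedPairs≡ (trans card≡∑χ (∑-cong points (λ u → sym (⟦⟧-idem (T? (E u)))))) ⟩
    (∑[ u ∈ points ] ∑[ v ∈ points ] ⟦ ¬? (u ≟ᴾ v) ⟧ * (χ u * χ v)) + (∑[ u ∈ points ] χ u * χ u)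
      ≡⟨ ∑-offDiagonal points-enum _≟ᴾ_ (λ u v → χ u * χ v) ⟩
    ∑[ u ∈ points ] ∑[ v ∈ points ] χ u * χ v
      ≡⟨ sym (∑*∑ points points χ χ) ⟩
    ∑ points χ * ∑ points χ
      ≡⟨ cong₂ _*_ (sym card≡∑χ) (sym card≡∑χ) ⟩
    card F E * card F E ∎
    where
    open ≡-Reasoning
    ∑alignedPairs≡ : ∑ directions alignedPairs ≡ ∑[ u ∈ points ] ∑[ v ∈ points ] ⟦ ¬? (u ≟ᴾ v) ⟧ * (χ u * χ v)
    ∑alignedPairs≡ = begin
      ∑[ d ∈ directions ] ∑[ p ∈ pairs ] ⟦ Aligned? d p ⟧  ≡⟨ ∑-comm directions pairs _ ⟩
      ∑[ p ∈ pairs ] ∑[ d ∈ directions ] ⟦ Aligned? d p ⟧  ≡⟨ ∑-cong pairs ∑-directions-aligned ⟩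
      ∑[ p ∈ pairs ] ⟦ Distinct? p ⟧                       ≡⟨ ∑-cartesianProduct points points _ ⟩
      ∑[ u ∈ points ] ∑[ v ∈ points ] ⟦ Distinct? (u , v) ⟧
        ≡⟨ ∑-cong points (λ u → ∑-cong points (⟦distinct⟧ u)) ⟩
      ∑[ u ∈ points ] ∑[ v ∈ points ] ⟦ ¬? (u ≟ᴾ v) ⟧ * (χ u * χ v) ∎

  quad⇔aligned : ∀ u v x y → Quad F E (u , v , x , y) ⇔ (∃[ d ] (Aligned d (u , v) × Aligned d (x , y)))
  quad⇔aligned u v x y = mk⇔ to from
    where
    to : Quad F E (u , v , x , y) → ∃[ d ] (Aligned d (u , v) × Aligned d (x , y))
    to (Eu , Ev , Ex , Ey , x≢y , u≢v , parallel) =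
      direction (x -ᴾ y) , (u≢v , πu≡πv , Eu , Ev) , distinct⇒aligned (x≢y , Ex , Ey)
      where
      πu≡πv : π (direction (x -ᴾ y)) u ≡ π (direction (x -ᴾ y)) v
      πu≡πv = Equivalence.from (π≡⇔π-sub≡0 (direction (x -ᴾ y)) u v)
                (Equivalence.from (π-direction≡0⇔parallel (x -ᴾ y) (u -ᴾ v) (-ᴾ≢origin x≢y) (-ᴾ≢origin u≢v))
                                  parallel)
    from : ∃[ d ] (Aligned d (u , v) × Aligned d (x , y)) → Quad F E (u , v , x , y)
    from (d , (u≢v , πu≡πv , Eu , Ev) , Axy@(x≢y , _ , Ex , Ey)) =
      Eu , Ev , Ex , Ey , x≢y , u≢v ,
      Equivalence.to (π-direction≡0⇔parallel (x -ᴾ y) (u -ᴾ v) (-ᴾ≢origin x≢y) (-ᴾ≢origin u≢v))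
        (trans (cong (λ d′ → π d′ (u -ᴾ v)) (sym (aligned⇒direction d Axy)))
               (Equivalence.to (π≡⇔π-sub≡0 d u v) πu≡πv))

  ⟦quad⟧≡∑-directions : ∀ u v x y → ⟦ Quad? F E (u , v , x , y) ⟧
                         ≡ ∑[ d ∈ directions ] ⟦ Aligned? d (u , v) ⟧ * ⟦ Aligned? d (x , y) ⟧
  ⟦quad⟧≡∑-directions u v x y = sym (trans
    (∑-cong directions (λ d → sym (⟦⟧-× (Aligned? d (u , v)) (Aligned? d (x , y)))))
    (∑⟦⟧-atMostOne directions-enum (λ d → Aligned? d (u , v) ×-dec Aligned? d (x , y))
      (λ {d} {d′} (_ , Axy) (_ , Axy′) → trans (aligned⇒direction d Axy) (sym (aligned⇒direction d′ Axy′)))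
      (Quad? F E (u , v , x , y)) (quad⇔aligned u v x y)))

  ∑-allQuads : (f : Point F × Point F × Point F × Point F → ℕ) →
               ∑ (allQuads F) f ≡ ∑[ p ∈ pairs ] ∑[ p′ ∈ pairs ] f (proj₁ p , proj₂ p , p′)
  ∑-allQuads f = begin
    ∑ (allQuads F) f
      ≡⟨ ∑-cartesianProduct points (cartesianProduct points pairs) f ⟩
    ∑[ u ∈ points ] ∑[ r ∈ cartesianProduct points pairs ] f (u , r)
      ≡⟨ ∑-cong points (λ u → ∑-cartesianProduct points pairs (λ r → f (u , r))) ⟩
    ∑[ u ∈ points ] ∑[ v ∈ points ] ∑[ p′ ∈ pairs ] f (u , v , p′)
      ≡⟨ sym (∑-cartesianProduct points points (λ p → ∑[ p′ ∈ pairs ] f (proj₁ p , proj₂ p , p′))) ⟩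
    ∑[ p ∈ pairs ] ∑[ p′ ∈ pairs ] f (proj₁ p , proj₂ p , p′) ∎
    where open ≡-Reasoning

  L2≡∑alignedPairs² : L2 F E ≡ ∑[ d ∈ directions ] alignedPairs d * alignedPairs d
  L2≡∑alignedPairs² = begin
    L2 F E
      ≡⟨ length-filter≡∑⟦⟧ (Quad? F E) (allQuads F) ⟩
    ∑[ w ∈ allQuads F ] ⟦ Quad? F E w ⟧
      ≡⟨ ∑-allQuads (λ w → ⟦ Quad? F E w ⟧) ⟩
    ∑[ p ∈ pairs ] ∑[ p′ ∈ pairs ] ⟦ Quad? F E (proj₁ p , proj₂ p , p′) ⟧
      ≡⟨ ∑-cong pairs (λ (u , v) → ∑-cong pairs (λ (x , y) → ⟦quad⟧≡∑-directions u v x y)) ⟩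
    ∑[ p ∈ pairs ] ∑[ p′ ∈ pairs ] ∑[ d ∈ directions ] ⟦ Aligned? d p ⟧ * ⟦ Aligned? d p′ ⟧
      ≡⟨ ∑-cong pairs (λ p → ∑-comm pairs directions _) ⟩
    ∑[ p ∈ pairs ] ∑[ d ∈ directions ] ∑[ p′ ∈ pairs ] ⟦ Aligned? d p ⟧ * ⟦ Aligned? d p′ ⟧
      ≡⟨ ∑-comm pairs directions _ ⟩
    ∑[ d ∈ directions ] ∑[ p ∈ pairs ] ∑[ p′ ∈ pairs ] ⟦ Aligned? d p ⟧ * ⟦ Aligned? d p′ ⟧
      ≡⟨ ∑-cong directions (λ d → sym (∑*∑ pairs pairs (⟦_⟧ ∘ Aligned? d) (⟦_⟧ ∘ Aligned? d))) ⟩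
    ∑[ d ∈ directions ] alignedPairs d * alignedPairs d ∎
    where open ≡-Reasoning

open import Data.Nat using (ℕ; _*_; _^_; _≤_; _<_; s≤s; z≤n)
open import Data.Bool using (Bool)
open import Data.Product using (_×_; ∃-syntax)
open import Data.Integer using (+_; _-_; ∣_∣)
import Data.Integer as ℤ

module _ where

  open import Data.Nat using (zero; suc; NonZero)
  open import Data.Nat.Properties using (module ≤-Reasoning)
  open import Data.Nat.Tactic.RingSolver using (solve-∀)
  import Data.Integer.Properties as ℤ

  finiteField⇒nonZero : ∀ {q} → FiniteField q → NonZero q
  finiteField⇒nonZero {zero} F with () ← FiniteField.0# F
  finiteField⇒nonZero {suc q} F = _

  -- The solver does not handle _^_, but small powers unfold definitionally.
  e⁴≡e²e² : ∀ e → e ^ 4 ≡ e * e * (e * e)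
  e⁴≡e²e² = unfolded
    where
    unfolded : ∀ e → e * (e * (e * (e * 1))) ≡ e * e * (e * e)
    unfolded = solve-∀

  q³e²≡qqqee : ∀ q e → q ^ 3 * e ^ 2 ≡ q * q * q * (e * e)
  q³e²≡qqqee = unfolded
    where
    unfolded : ∀ q e → q * (q * (q * 1)) * (e * (e * 1)) ≡ q * q * q * (e * e)
    unfolded = solve-∀

  energy-bound : ∀ (q : ℕ) (F : FiniteField q) (E : Point F → Bool) →
                 ∣ (+ q) ℤ.* (+ L2 F E) - (+ (card F E ^ 4)) ∣ ≤ 8 * (q ^ 3 * card F E ^ 2)
  energy-bound q F E = begin
    ∣ + q ℤ.* + L2 F E - + (e ^ 4) ∣
      ≡⟨ cong₂ (λ a b → ∣ a - + b ∣)
               (trans (sym (ℤ.pos-* q (L2 F E))) (cong (λ L → + (q * L)) L2≡∑alignedPairs²))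
               (e⁴≡e²e² e) ⟩
    ∣ + (q * (∑[ d ∈ directions ] alignedPairs d * alignedPairs d)) - + (e * e * (e * e)) ∣
      ≤⟨ energy-estimate directions alignedPairs q e length-directions ∑alignedPairs+card≡card² card≤q²
                         card²≤q[alignedPairs+card] ⟩
    8 * (q * q * q * (e * e))
      ≡⟨ cong (8 *_) (sym (q³e²≡qqqee q e)) ⟩
    8 * (q ^ 3 * e ^ 2) ∎
    where
    open ≤-Reasoning
    open FiniteSums using (∑-syntax)
    open Counting F E
    open EnergyEstimate using (energy-estimate)
    instance
      q≢0 : NonZero q
      q≢0 = finiteField⇒nonZero F
    e : ℕ
    e = card F E

theorem1p3 : ∃[ C ] (0 < C × (∀ (q : ℕ) (F : FiniteField q) (E : Point F → Bool) →
               ∣ (+ q) ℤ.* (+ L2 F E) - (+ (card F E ^ 4)) ∣ ≤ C * (q ^ 3 * card F E ^ 2)))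
theorem1p3 = 8 , s≤s z≤n , energy-bound
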